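{- Let $C=(C_1,C_2)$ be an equitable partition of $J(n,w)$ with quotient matrix $\begin{pmatrix} a & b\\ c & d\end{pmatrix}$, and let $f=\chi_{C_1}$. Then $$\frac{bc}{b+c}\binom{n}{w}=\sum_{1\leq i<j\leq n}|S(f_{i,j})|,$$ where $S(f_{i,j})$ is the support (set of non-zeros) of the partial difference $f_{i,j}$.
   Context: The Johnson graph $J(n,w)$ has as vertices the binary vectors of length $n$ with exactly $w$ ones; two vertices are adjacent if they have exactly $w-1$ common ones. A partition $(C_1,C_2)$ of the vertex set is equitable with quotient matrix $S=(s_{ij})$ if every vertex of $C_i$ has exactly $s_{ij}$ neighbours in $C_j$. $\chi_A$ denotes the characteristic function of $A$. For $f:J(n,w)\to\mathbb{R}$ and $i<j$, the partial difference $f_{i,j}:J(n-2,w-1)\to\mathbb{R}$ is defined, for $y\in J(n-2,w-1)$ indexed by the coordinates $\{1,\dots,n\}\setminus\{i,j\}$, as $f_{i,j}(y)=f(y \text{ with } 1 \text{ at } i \text{ and } 0 \text{ at } j)-f(y \text{ with } 0 \text{ at } i \text{ and } 1 \text{ at } j)$. -}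

module Defs where

open import Data.Bool using (Bool; true; false; if_then_else_; not; _∧_)
open import Data.Nat using (ℕ; zero; suc; _≡ᵇ_; _<ᵇ_; _+_)
open import Data.Fin using (Fin; zero; suc; toℕ)
open import Data.List using (List; []; _∷_; map; _++_; filterᵇ; length; allFin; concatMap)
open import Data.Nat.ListAction using (sum)
open import Data.Vec using (Vec; []; _∷_; insertAt; countᵇ; zipWith)
open import Data.Integer using (ℤ; +_; _-_; _≟_)
open import Data.Product using (Σ; _×_; _,_)
open import Relation.Nullary using (does)
open import Relation.Binary.PropositionalEquality using (_≡_)
open import Data.List.Membership.Propositional using (_∈_)

allVecs : (n : ℕ) → List (Vec Bool n)
allVecs zero = [] ∷ []
allVecs (suc n) = map (true ∷_) (allVecs n) ++ map (false ∷_) (allVecs n)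

weight : ∀ {n} → Vec Bool n → ℕ
weight = countᵇ (λ b → b)

-- vertex set of J(n,w): binary vectors of length n with exactly w ones
vertices : (n w : ℕ) → List (Vec Bool n)
vertices n w = filterᵇ (λ v → weight v ≡ᵇ w) (allVecs n)

common : ∀ {n} → Vec Bool n → Vec Bool n → ℕ
common x y = weight (zipWith _∧_ x y)

-- adjacency in J(n,w): exactly w-1 common ones (never adjacent when w = 0)
adjᵇ : ∀ {n} (w : ℕ) → Vec Bool n → Vec Bool n → Bool
adjᵇ w x y = (common x y + 1) ≡ᵇ w

nbrsIn : (n w : ℕ) → Vec Bool n → (Vec Bool n → Bool) → ℕ
nbrsIn n w x D = length (filterᵇ (λ y → adjᵇ w x y ∧ D y) (vertices n w))

-- (C₁, C₂) with C₁ = {x | P x = true}, C₂ = {x | P x = false} is an equitable partition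
-- of J(n,w) (both parts nonempty) with quotient matrix ((a , b) , (c , d)).
record IsEquitable (n w : ℕ) (P : Vec Bool n → Bool) (a b c d : ℕ) : Set where
  field
    C₁-nonempty : Σ (Vec Bool n) λ x → x ∈ vertices n w × P x ≡ true
    C₂-nonempty : Σ (Vec Bool n) λ x → x ∈ vertices n w × P x ≡ false
    row₁₁ : ∀ x → x ∈ vertices n w → P x ≡ true → nbrsIn n w x P ≡ a
    row₁₂ : ∀ x → x ∈ vertices n w → P x ≡ true → nbrsIn n w x (λ y → not (P y)) ≡ b
    row₂₁ : ∀ x → x ∈ vertices n w → P x ≡ false → nbrsIn n w x P ≡ c
    row₂₂ : ∀ x → x ∈ vertices n w → P x ≡ false → nbrsIn n w x (λ y → not (P y)) ≡ d

χ : ∀ {n} → (Vec Bool n → Bool) → Vec Bool n → ℤ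
χ P x = if P x then + 1 else + 0

-- For i < j in Fin (m+2) and y ∈ J(m, ·) indexed by the coordinates other than i, j:
-- the vector with bit bᵢ at i, bit bⱼ at j, and y on the remaining coordinates (in order).
-- (j = suc k; first insert bⱼ at position k of y, then bᵢ at position i.)
place : ∀ {m} (i j : Fin (suc (suc m))) → Vec Bool m → Bool → Bool → Vec Bool (suc (suc m))
place i zero    y bi bj = insertAt (insertAt y zero bj) i bi   -- unused (requires i < j)
place i (suc k) y bi bj = insertAt (insertAt y k bj) i bi

partialDiff : ∀ {m} → (Vec Bool (suc (suc m)) → ℤ) → (i j : Fin (suc (suc m))) → Vec Bool m → ℤ
partialDiff f i j y = f (place i j y true false) - f (place i j y false true)

-- |S(f_{i,j})| : number of y ∈ J(n-2, w-1) with f_{i,j}(y) ≠ 0 (J(n-2,-1) is empty)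
supportSize : ∀ {m} (w : ℕ) → (Vec Bool (suc (suc m)) → ℤ) → (i j : Fin (suc (suc m))) → ℕ
supportSize {m} zero    f i j = 0
supportSize {m} (suc w) f i j =
  length (filterᵇ (λ y → not (does (partialDiff f i j y ≟ + 0))) (vertices m w))

sumSupports : (n w : ℕ) → (Vec Bool n → ℤ) → ℕ
sumSupports zero w f = 0
sumSupports (suc zero) w f = 0
sumSupports (suc (suc m)) w f =
  sum (concatMap (λ i → map (λ j → supportSize w f i j)
                            (filterᵇ (λ j → toℕ i <ᵇ toℕ j) (allFin (suc (suc m)))))
                 (allFin (suc (suc m))))

module Submission where

-- Double counting the edges of J(n,w) that cross an equitable partition (C₁ , C₂).
--
-- Let E be the number of ordered pairs (x , z) of adjacent vertices with x ∈ C₁ and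
-- z ∈ C₂.  Summing over x ∈ C₁ gives E = b·|C₁|; summing over z ∈ C₂ gives E = c·|C₂|.
-- On the other hand every edge {x , z} of J(n,w) arises from exactly one triple
-- (i < j , y ∈ J(n-2,w-1)): x is y completed by 1 at i and 0 at j, and z is y
-- completed by 0 at i and 1 at j.  The edge crosses the partition exactly when f_{i,j}(y) ≠ 0 for f = χ_{C₁}.
-- Hence Σ_{i<j} |S(f_{i,j})| = E, and (b + c)·E = bc·(|C₁| + |C₂|) = bc·binom(n,w).
--
-- The case w = 0 is degenerate: J(n,0) has no edges, so b = c = 0.

open import Defs
open import Data.Bool using (Bool; true; false; if_then_else_; not; _∧_; _xor_; T)
open import Data.Bool.Properties using (∧-identityʳ; ∧-zeroʳ; not-injective)
open import Data.Fin using (Fin; zero; suc; toℕ)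
open import Data.Integer using (_-_; _≟_) renaming (+_ to pos)
open import Data.List using (List; []; _∷_; map; _++_; filterᵇ; length; allFin; concatMap)
open import Data.List.Membership.Propositional using (_∈_)
open import Data.List.Properties using (map-++; map-∘; map-tabulate)
open import Data.List.Relation.Unary.Any using (here; there)
open import Data.Nat using (ℕ; zero; suc; _+_; _*_; _≡ᵇ_; _<ᵇ_; _≤_; z≤n; s≤s)
open import Data.Nat.Combinatorics using (_C_; nCk+nC[k+1]≡[n+1]C[k+1])
open import Data.Nat.ListAction using (sum)
open import Data.Nat.ListAction.Properties using (sum-++)
open import Data.Nat.Properties
  using (+-commutativeSemigroup; +-comm; +-assoc; +-identityʳ; *-zeroʳ; *-identityʳ;
         *-assoc; *-comm; +-suc; *-distribˡ-+; *-distribʳ-+; ≡ᵇ⇒≡; suc-injective; m≤n⇒m≤1+n)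
open import Data.Product using (_,_)
open import Algebra.Properties.CommutativeSemigroup +-commutativeSemigroup
  using (interchange; x∙yz≈y∙xz)
open import Data.Unit using (tt)
open import Data.Vec using (Vec; []; _∷_; insertAt)
open import Relation.Nullary using (does)
open import Relation.Binary.PropositionalEquality
open ≡-Reasoning

⟦_⟧ : Bool → ℕ
⟦ b ⟧ = if b then 1 else 0

∑ : {A : Set} → List A → (A → ℕ) → ℕ
∑ xs f = sum (map f xs)

∑-cong∈ : ∀ {A : Set} (xs : List A) {f g : A → ℕ} →
  (∀ x → x ∈ xs → f x ≡ g x) → ∑ xs f ≡ ∑ xs g
∑-cong∈ []       e = refl
∑-cong∈ (x ∷ xs) e = cong₂ _+_ (e x (here refl)) (∑-cong∈ xs (λ y p → e y (there p)))

∑-cong : ∀ {A : Set} (xs : List A) {f g : A → ℕ} → (∀ x → f x ≡ g x) → ∑ xs f ≡ ∑ xs g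
∑-cong xs e = ∑-cong∈ xs (λ x _ → e x)

∑-0 : ∀ {A : Set} (xs : List A) → ∑ xs (λ _ → 0) ≡ 0
∑-0 []       = refl
∑-0 (x ∷ xs) = ∑-0 xs

∑-+ : ∀ {A : Set} (xs : List A) (f g : A → ℕ) → ∑ xs (λ x → f x + g x) ≡ ∑ xs f + ∑ xs g
∑-+ []       f g = refl
∑-+ (x ∷ xs) f g = trans (cong (f x + g x +_) (∑-+ xs f g)) (interchange (f x) (g x) _ _)

∑-*ˡ : ∀ {A : Set} (xs : List A) (k : ℕ) (f : A → ℕ) → k * ∑ xs f ≡ ∑ xs (λ x → k * f x)
∑-*ˡ []       k f = *-zeroʳ k
∑-*ˡ (x ∷ xs) k f = trans (*-distribˡ-+ k (f x) _) (cong (k * f x +_) (∑-*ˡ xs k f))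

∑-++ : ∀ {A : Set} (xs ys : List A) (f : A → ℕ) → ∑ (xs ++ ys) f ≡ ∑ xs f + ∑ ys f
∑-++ xs ys f = trans (cong sum (map-++ f xs ys)) (sum-++ (map f xs) (map f ys))

∑-map : ∀ {A B : Set} (xs : List A) (g : A → B) (f : B → ℕ) →
  ∑ (map g xs) f ≡ ∑ xs (λ x → f (g x))
∑-map xs g f = cong sum (sym (map-∘ xs))

∑-swap : ∀ {A B : Set} (xs : List A) (ys : List B) (f : A → B → ℕ) →
  ∑ xs (λ x → ∑ ys (f x)) ≡ ∑ ys (λ y → ∑ xs (λ x → f x y))
∑-swap []       ys f = sym (∑-0 ys)
∑-swap (x ∷ xs) ys f = trans (cong (∑ ys (f x) +_) (∑-swap xs ys f)) (sym (∑-+ ys (f x) _))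

∑-filter : ∀ {A : Set} (p : A → Bool) (xs : List A) (f : A → ℕ) →
  ∑ (filterᵇ p xs) f ≡ ∑ xs (λ x → if p x then f x else 0)
∑-filter p []       f = refl
∑-filter p (x ∷ xs) f with p x
... | true  = cong (f x +_) (∑-filter p xs f)
... | false = ∑-filter p xs f

length≡∑1 : ∀ {A : Set} (xs : List A) → length xs ≡ ∑ xs (λ _ → 1)
length≡∑1 []       = refl
length≡∑1 (x ∷ xs) = cong suc (length≡∑1 xs)

length-filterᵇ : ∀ {A : Set} (p : A → Bool) (xs : List A) →
  length (filterᵇ p xs) ≡ ∑ xs (λ x → ⟦ p x ⟧)
length-filterᵇ p []       = refl
length-filterᵇ p (x ∷ xs) with p x
... | true  = cong suc (length-filterᵇ p xs)
... | false = length-filterᵇ p xs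

sum-concatMap : ∀ {A : Set} (g : A → List ℕ) (xs : List A) →
  sum (concatMap g xs) ≡ ∑ xs (λ x → sum (g x))
sum-concatMap g []       = refl
sum-concatMap g (x ∷ xs) =
  trans (sum-++ (g x) (concatMap g xs)) (cong (sum (g x) +_) (sum-concatMap g xs))

∑-allFin : ∀ n (f : Fin (suc n) → ℕ) → ∑ (allFin (suc n)) f ≡ f zero + ∑ (allFin n) (λ k → f (suc k))
∑-allFin n f = cong (f zero +_)
  (trans (cong sum (map-tabulate suc f)) (sym (cong sum (map-tabulate (λ k → k) (λ k → f (suc k))))))

∑cube : (n : ℕ) → (Vec Bool n → ℕ) → ℕ
∑cube n = ∑ (allVecs n)

∑cube-step : ∀ n (f : Vec Bool (suc n) → ℕ) →
  ∑cube (suc n) f ≡ ∑cube n (λ v → f (true ∷ v)) + ∑cube n (λ v → f (false ∷ v))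
∑cube-step n f = trans (∑-++ (map (true ∷_) (allVecs n)) _ f)
  (cong₂ _+_ (∑-map (allVecs n) (true ∷_) f) (∑-map (allVecs n) (false ∷_) f))

same : ∀ {n} → Vec Bool n → Vec Bool n → Bool
same []          []          = true
same (true ∷ x)  (true ∷ z)  = same x z
same (true ∷ x)  (false ∷ z) = false
same (false ∷ x) (true ∷ z)  = false
same (false ∷ x) (false ∷ z) = same x z

∑cube-same : ∀ n (x : Vec Bool n) (k : Vec Bool n → ℕ) →
  ∑cube n (λ z → if same x z then k z else 0) ≡ k x
∑cube-same zero    []          k = +-identityʳ (k [])
∑cube-same (suc n) (true ∷ x)  k = begin
  ∑cube (suc n) (λ z → if same (true ∷ x) z then k z else 0)   ≡⟨ ∑cube-step n _ ⟩
  ∑cube n (λ z → if same x z then k (true ∷ z) else 0) + ∑cube n (λ _ → 0)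
    ≡⟨ cong₂ _+_ (∑cube-same n x (λ z → k (true ∷ z))) (∑-0 (allVecs n)) ⟩
  k (true ∷ x) + 0                                              ≡⟨ +-identityʳ _ ⟩
  k (true ∷ x)                                                  ∎
∑cube-same (suc n) (false ∷ x) k = begin
  ∑cube (suc n) (λ z → if same (false ∷ x) z then k z else 0)  ≡⟨ ∑cube-step n _ ⟩
  ∑cube n (λ _ → 0) + ∑cube n (λ z → if same x z then k (false ∷ z) else 0)
    ≡⟨ cong₂ _+_ (∑-0 (allVecs n)) (∑cube-same n x (λ z → k (false ∷ z))) ⟩
  k (false ∷ x)                                                 ∎

Kernel : ℕ → Set
Kernel n = Vec Bool n → Vec Bool n → ℕ

∑² : (n : ℕ) → Kernel n → ℕ
∑² n h = ∑cube n (λ x → ∑cube n (h x))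

∑²-0 : ∀ n → ∑² n (λ _ _ → 0) ≡ 0
∑²-0 n = trans (∑-cong (allVecs n) (λ _ → ∑-0 (allVecs n))) (∑-0 (allVecs n))

∑²-cong : ∀ n {h h′ : Kernel n} → (∀ x z → h x z ≡ h′ x z) → ∑² n h ≡ ∑² n h′
∑²-cong n e = ∑-cong (allVecs n) (λ x → ∑-cong (allVecs n) (e x))

∑²-+ : ∀ n (h h′ : Kernel n) → ∑² n (λ x z → h x z + h′ x z) ≡ ∑² n h + ∑² n h′
∑²-+ n h h′ = trans (∑-cong (allVecs n) (λ x → ∑-+ (allVecs n) (h x) (h′ x))) (∑-+ (allVecs n) _ _)

∑²-transpose : ∀ n (h : Kernel n) → ∑² n h ≡ ∑² n (λ x z → h z x)
∑²-transpose n h = ∑-swap (allVecs n) (allVecs n) h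

infixl 10 _↾_
_↾_ : ∀ {n} → Kernel n → (Vec Bool n → Vec Bool n → Bool) → Kernel n
(h ↾ r) x z = if r x z then h x z else 0

infixl 20 _⟨_∣_⟩
_⟨_∣_⟩ : ∀ {n} → Kernel (suc n) → Bool → Bool → Kernel n
(h ⟨ b ∣ b′ ⟩) x z = h (b ∷ x) (b′ ∷ z)

∑²-step : ∀ n (h : Kernel (suc n)) →
  ∑² (suc n) h ≡ (∑² n (h ⟨ true ∣ true ⟩) + ∑² n (h ⟨ true ∣ false ⟩))
               + (∑² n (h ⟨ false ∣ true ⟩) + ∑² n (h ⟨ false ∣ false ⟩))
∑²-step n h = begin
  ∑² (suc n) h
    ≡⟨ ∑cube-step n _ ⟩
  ∑cube n (λ x → ∑cube (suc n) (h (true ∷ x))) + ∑cube n (λ x → ∑cube (suc n) (h (false ∷ x)))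
    ≡⟨ cong₂ _+_ (∑-cong (allVecs n) (λ x → ∑cube-step n (h (true ∷ x))))
                 (∑-cong (allVecs n) (λ x → ∑cube-step n (h (false ∷ x)))) ⟩
  ∑cube n (λ x → ∑cube n ((h ⟨ true ∣ true ⟩) x) + ∑cube n ((h ⟨ true ∣ false ⟩) x))
    + ∑cube n (λ x → ∑cube n ((h ⟨ false ∣ true ⟩) x) + ∑cube n ((h ⟨ false ∣ false ⟩) x))
    ≡⟨ cong₂ _+_ (∑-+ (allVecs n) _ _) (∑-+ (allVecs n) _ _) ⟩
  (∑² n (h ⟨ true ∣ true ⟩) + ∑² n (h ⟨ true ∣ false ⟩))
    + (∑² n (h ⟨ false ∣ true ⟩) + ∑² n (h ⟨ false ∣ false ⟩)) ∎

-- raises x z : z arises from x by turning exactly one 0 into a 1.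
raises : ∀ {n} → Vec Bool n → Vec Bool n → Bool
raises []          []          = false
raises (true ∷ x)  (true ∷ z)  = raises x z
raises (true ∷ x)  (false ∷ z) = false
raises (false ∷ x) (true ∷ z)  = same x z
raises (false ∷ x) (false ∷ z) = raises x z

-- shifts x z : z arises from x by moving a single 1 to a later coordinate.
shifts : ∀ {n} → Vec Bool n → Vec Bool n → Bool
shifts []          []          = false
shifts (true ∷ x)  (true ∷ z)  = shifts x z
shifts (true ∷ x)  (false ∷ z) = raises x z
shifts (false ∷ x) (true ∷ z)  = false
shifts (false ∷ x) (false ∷ z) = shifts x z

-- Pairs related by raises, enumerated by the raised coordinate j and the other bits y.
∑raise : ∀ m → Kernel (suc m) → ℕ
∑raise m h = ∑ (allFin (suc m)) (λ j → ∑cube m (λ y → h (insertAt y j false) (insertAt y j true)))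

-- Splitting off the first coordinate: raising it gives the diagonal (0 ∷ y , 1 ∷ y);
-- otherwise the first bit y₀ is shared and a later coordinate is raised.
∑raise-step : ∀ m (h : Kernel (suc (suc m))) →
  ∑raise (suc m) h ≡ ∑cube (suc m) (λ y → h (false ∷ y) (true ∷ y))
                   + (∑raise m (h ⟨ true ∣ true ⟩) + ∑raise m (h ⟨ false ∣ false ⟩))
∑raise-step m h = trans (∑-allFin (suc m) (λ j → ∑cube (suc m) (pairAt j)))
  (cong (∑cube (suc m) (λ y → h (false ∷ y) (true ∷ y)) +_)
    (trans (∑-cong (allFin (suc m)) (λ k → ∑cube-step m (pairAt (suc k))))
           (∑-+ (allFin (suc m)) (λ k → ∑cube m (λ y → pairAt (suc k) (true ∷ y)))
                                 (λ k → ∑cube m (λ y → pairAt (suc k) (false ∷ y))))))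
  where
  pairAt : Fin (suc (suc m)) → Vec Bool (suc m) → ℕ
  pairAt j y = h (insertAt y j false) (insertAt y j true)

-- Summing over raise-related pairs.  By first coordinates, the blocks (1,1) and (0,0)
-- recurse, (1,0) is empty and (0,1) forces the remaining bits to agree.
∑²-raises : ∀ m (h : Kernel (suc m)) → ∑² (suc m) (h ↾ raises) ≡ ∑raise m h
∑²-raises zero    h = refl
∑²-raises (suc m) h = begin
  ∑² (suc (suc m)) (h ↾ raises)
    ≡⟨ ∑²-step (suc m) (h ↾ raises) ⟩
  (TT + ∑² (suc m) (λ _ _ → 0)) + (∑² (suc m) (h ⟨ false ∣ true ⟩ ↾ same) + FF)
    ≡⟨ cong₂ (λ u v → (TT + u) + (v + FF)) (∑²-0 (suc m))
         (∑-cong (allVecs (suc m)) (λ x → ∑cube-same (suc m) x ((h ⟨ false ∣ true ⟩) x))) ⟩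
  (TT + 0) + (diagonal + FF)
    ≡⟨ trans (cong (_+ (diagonal + FF)) (+-identityʳ TT)) (x∙yz≈y∙xz TT diagonal FF) ⟩
  diagonal + (TT + FF)
    ≡⟨ cong₂ (λ u v → diagonal + (u + v)) (∑²-raises m (h ⟨ true ∣ true ⟩)) (∑²-raises m (h ⟨ false ∣ false ⟩)) ⟩
  diagonal + (∑raise m (h ⟨ true ∣ true ⟩) + ∑raise m (h ⟨ false ∣ false ⟩))
    ≡⟨ sym (∑raise-step m h) ⟩
  ∑raise (suc m) h ∎
  where
  TT FF diagonal : ℕ
  TT = ∑² (suc m) (h ⟨ true ∣ true ⟩ ↾ raises)
  FF = ∑² (suc m) (h ⟨ false ∣ false ⟩ ↾ raises)
  diagonal = ∑cube (suc m) (λ y → h (false ∷ y) (true ∷ y))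

∑< : ∀ n → (Fin n → Fin n → ℕ) → ℕ
∑< n g = ∑ (allFin n) (λ i → ∑ (allFin n) (λ j → if toℕ i <ᵇ toℕ j then g i j else 0))

∑<-step : ∀ n (g : Fin (suc n) → Fin (suc n) → ℕ) →
  ∑< (suc n) g ≡ ∑ (allFin n) (λ k → g zero (suc k)) + ∑< n (λ i j → g (suc i) (suc j))
∑<-step n g = trans (∑-allFin n (λ i → ∑ (allFin (suc n)) (row i)))
  (cong₂ _+_ (∑-allFin n (row zero)) (∑-cong (allFin n) (λ i → ∑-allFin n (row (suc i)))))
  where
  row : Fin (suc n) → Fin (suc n) → ℕ
  row i j = if toℕ i <ᵇ toℕ j then g i j else 0

∑<-cong : ∀ n {g g′ : Fin n → Fin n → ℕ} →
  (∀ i j → (toℕ i <ᵇ toℕ j) ≡ true → g i j ≡ g′ i j) → ∑< n g ≡ ∑< n g′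
∑<-cong n {g} {g′} e = ∑-cong (allFin n) (λ i → ∑-cong (allFin n) (entry i))
  where
  entry : ∀ i j → (if toℕ i <ᵇ toℕ j then g i j else 0) ≡ (if toℕ i <ᵇ toℕ j then g′ i j else 0)
  entry i j with toℕ i <ᵇ toℕ j in i<j
  ... | true  = e i j i<j
  ... | false = refl

∑<-+ : ∀ n (g g′ : Fin n → Fin n → ℕ) → ∑< n (λ i j → g i j + g′ i j) ≡ ∑< n g + ∑< n g′
∑<-+ n g g′ = trans (∑-cong (allFin n) (λ i → trans (∑-cong (allFin n) (entry i)) (∑-+ (allFin n) _ _)))
                   (∑-+ (allFin n) _ _)
  where
  entry : ∀ i j → (if toℕ i <ᵇ toℕ j then g i j + g′ i j else 0)
                ≡ (if toℕ i <ᵇ toℕ j then g i j else 0) + (if toℕ i <ᵇ toℕ j then g′ i j else 0)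
  entry i j with toℕ i <ᵇ toℕ j
  ... | true  = refl
  ... | false = refl

∑move : ∀ m → Kernel (suc (suc m)) → Fin (suc (suc m)) → Fin (suc (suc m)) → ℕ
∑move m h i j = ∑cube m (λ y → h (place i j y true false) (place i j y false true))

-- Pairs related by shifts are enumerated by the coordinates i < j of the moved 1
-- and the remaining bits y.  By first coordinates, (1,0) means the 1 leaves
-- coordinate 0 (a raise of the rest), (0,1) is impossible, and (1,1), (0,0) recurse.
∑²-shifts : ∀ m (h : Kernel (suc (suc m))) → ∑² (suc (suc m)) (h ↾ shifts) ≡ ∑< (suc (suc m)) (∑move m h)
∑²-shifts m h = begin
  ∑² (suc (suc m)) (h ↾ shifts)
    ≡⟨ ∑²-step (suc m) (h ↾ shifts) ⟩
  (TT + TF) + (∑² (suc m) (λ _ _ → 0) + FF)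
    ≡⟨ cong (λ u → (TT + TF) + (u + FF)) (∑²-0 (suc m)) ⟩
  (TT + TF) + FF
    ≡⟨ trans (cong (_+ FF) (+-comm TT TF)) (+-assoc TF TT FF) ⟩
  TF + (TT + FF)
    ≡⟨ cong₂ _+_ (∑²-raises m (h ⟨ true ∣ false ⟩)) (shiftTail m h) ⟩
  ∑ (allFin (suc m)) (λ k → ∑move m h zero (suc k)) + ∑< (suc m) (λ i j → ∑move m h (suc i) (suc j))
    ≡⟨ sym (∑<-step (suc m) (∑move m h)) ⟩
  ∑< (suc (suc m)) (∑move m h) ∎
  where
  TT TF FF : ℕ
  TT = ∑² (suc m) (h ⟨ true ∣ true ⟩ ↾ shifts)
  TF = ∑² (suc m) (h ⟨ true ∣ false ⟩ ↾ raises)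
  FF = ∑² (suc m) (h ⟨ false ∣ false ⟩ ↾ shifts)
  -- Pairs agreeing in the first coordinate: both moved coordinates lie further right.
  shiftTail : ∀ m′ (h′ : Kernel (suc (suc m′))) →
    ∑² (suc m′) (h′ ⟨ true ∣ true ⟩ ↾ shifts) + ∑² (suc m′) (h′ ⟨ false ∣ false ⟩ ↾ shifts)
    ≡ ∑< (suc m′) (λ i j → ∑move m′ h′ (suc i) (suc j))
  shiftTail zero    h′ = refl
  shiftTail (suc m′) h′ = sym (begin
    ∑< (suc (suc m′)) (λ i j → ∑move (suc m′) h′ (suc i) (suc j))
      ≡⟨ ∑<-cong (suc (suc m′)) splitHead ⟩
    ∑< (suc (suc m′)) (λ i j → ∑move m′ (h′ ⟨ true ∣ true ⟩) i j + ∑move m′ (h′ ⟨ false ∣ false ⟩) i j)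
      ≡⟨ ∑<-+ (suc (suc m′)) (∑move m′ (h′ ⟨ true ∣ true ⟩)) (∑move m′ (h′ ⟨ false ∣ false ⟩)) ⟩
    ∑< (suc (suc m′)) (∑move m′ (h′ ⟨ true ∣ true ⟩)) + ∑< (suc (suc m′)) (∑move m′ (h′ ⟨ false ∣ false ⟩))
      ≡⟨ sym (cong₂ _+_ (∑²-shifts m′ (h′ ⟨ true ∣ true ⟩)) (∑²-shifts m′ (h′ ⟨ false ∣ false ⟩))) ⟩
    ∑² (suc (suc m′)) (h′ ⟨ true ∣ true ⟩ ↾ shifts) + ∑² (suc (suc m′)) (h′ ⟨ false ∣ false ⟩ ↾ shifts) ∎)
    where
    -- For j > 0 the first bit of y precedes both moved coordinates.
    splitHead : ∀ i j → (toℕ i <ᵇ toℕ j) ≡ true →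
      ∑move (suc m′) h′ (suc i) (suc j) ≡ ∑move m′ (h′ ⟨ true ∣ true ⟩) i j + ∑move m′ (h′ ⟨ false ∣ false ⟩) i j
    splitHead i zero    ()
    splitHead i (suc k) _ = ∑cube-step m′ _

common≤weightˡ : ∀ {n} (x z : Vec Bool n) → common x z ≤ weight x
common≤weightˡ []          []          = z≤n
common≤weightˡ (true ∷ x)  (true ∷ z)  = s≤s (common≤weightˡ x z)
common≤weightˡ (true ∷ x)  (false ∷ z) = m≤n⇒m≤1+n (common≤weightˡ x z)
common≤weightˡ (false ∷ x) (true ∷ z)  = common≤weightˡ x z
common≤weightˡ (false ∷ x) (false ∷ z) = common≤weightˡ x z

common-comm : ∀ {n} (x z : Vec Bool n) → common x z ≡ common z x
common-comm []          []          = refl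
common-comm (true ∷ x)  (true ∷ z)  = cong suc (common-comm x z)
common-comm (true ∷ x)  (false ∷ z) = common-comm x z
common-comm (false ∷ x) (true ∷ z)  = common-comm x z
common-comm (false ∷ x) (false ∷ z) = common-comm x z

common≤weightʳ : ∀ {n} (x z : Vec Bool n) → common x z ≤ weight z
common≤weightʳ x z = subst (_≤ weight z) (common-comm z x) (common≤weightˡ z x)

≤⇒≢ᵇsuc : ∀ {a b} → a ≤ b → (a ≡ᵇ suc b) ≡ false
≤⇒≢ᵇsuc {zero}  _       = refl
≤⇒≢ᵇsuc {suc a} (s≤s p) = ≤⇒≢ᵇsuc p

common-same : ∀ {n} (x z : Vec Bool n) → weight z ≡ weight x → (common x z ≡ᵇ weight x) ≡ same x z
common-same []          []          e = refl
common-same (true ∷ x)  (true ∷ z)  e = common-same x z (suc-injective e)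
common-same (true ∷ x)  (false ∷ z) e = ≤⇒≢ᵇsuc (common≤weightˡ x z)
common-same (false ∷ x) (true ∷ z)  e rewrite sym e = ≤⇒≢ᵇsuc (common≤weightʳ x z)
common-same (false ∷ x) (false ∷ z) e = common-same x z e

common-raises : ∀ {n} (x z : Vec Bool n) → weight z ≡ suc (weight x) →
  (common x z ≡ᵇ weight x) ≡ raises x z
common-raises []          []          ()
common-raises (true ∷ x)  (true ∷ z)  e = common-raises x z (suc-injective e)
common-raises (true ∷ x)  (false ∷ z) e = ≤⇒≢ᵇsuc (common≤weightˡ x z)
common-raises (false ∷ x) (true ∷ z)  e = common-same x z (suc-injective e)
common-raises (false ∷ x) (false ∷ z) e = common-raises x z e

adjacent-shifts : ∀ {n} (x z : Vec Bool n) → weight x ≡ weight z →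
  ⟦ suc (common x z) ≡ᵇ weight x ⟧ ≡ ⟦ shifts x z ⟧ + ⟦ shifts z x ⟧
adjacent-shifts []          []          e = refl
adjacent-shifts (true ∷ x)  (true ∷ z)  e = adjacent-shifts x z (suc-injective e)
adjacent-shifts (true ∷ x)  (false ∷ z) e rewrite common-raises x z (sym e) = sym (+-identityʳ _)
adjacent-shifts (false ∷ x) (true ∷ z)  e rewrite e | common-comm x z | common-raises z x e = refl
adjacent-shifts (false ∷ x) (false ∷ z) e = adjacent-shifts x z e

inJ : ∀ {n} → ℕ → Vec Bool n → Bool
inJ w x = weight x ≡ᵇ w

inJ⇒weight : ∀ {n} w (x : Vec Bool n) → inJ w x ≡ true → weight x ≡ w
inJ⇒weight w x e = ≡ᵇ⇒≡ (weight x) w (subst T (sym e) tt)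

adjᵇ-shifts : ∀ {n} w (x z : Vec Bool n) → inJ w x ≡ true → inJ w z ≡ true →
  ⟦ adjᵇ w x z ⟧ ≡ ⟦ shifts x z ⟧ + ⟦ shifts z x ⟧
adjᵇ-shifts w x z x∈J z∈J = begin
  ⟦ common x z + 1 ≡ᵇ w ⟧        ≡⟨ cong (λ t → ⟦ t ≡ᵇ w ⟧) (+-comm (common x z) 1) ⟩
  ⟦ suc (common x z) ≡ᵇ w ⟧      ≡⟨ cong (λ t → ⟦ suc (common x z) ≡ᵇ t ⟧) (sym wx≡w) ⟩
  ⟦ suc (common x z) ≡ᵇ weight x ⟧ ≡⟨ adjacent-shifts x z (trans wx≡w (sym (inJ⇒weight w z z∈J))) ⟩
  ⟦ shifts x z ⟧ + ⟦ shifts z x ⟧ ∎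
  where
  wx≡w : weight x ≡ w
  wx≡w = inJ⇒weight w x x∈J

nbrsIn-J0 : ∀ n (x : Vec Bool n) D → nbrsIn n 0 x D ≡ 0
nbrsIn-J0 n x D = trans (length-filterᵇ _ (vertices n 0)) (trans (∑-cong (vertices n 0) noEdge) (∑-0 (vertices n 0)))
  where
  noEdge : ∀ y → ⟦ adjᵇ 0 x y ∧ D y ⟧ ≡ 0
  noEdge y rewrite +-comm (common x y) 1 = refl

between : ∀ {n} → ℕ → (Q D : Vec Bool n → Bool) → Kernel n
between w Q D x z = ⟦ inJ w x ∧ inJ w z ∧ Q x ∧ D z ⟧

push-if : ∀ {A : Set} (a b : Bool) (xs : List A) (g : A → ℕ) →
  (if a then (if b then ∑ xs g else 0) else 0) ≡ ∑ xs (λ z → if a then (if b then g z else 0) else 0)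
push-if true  true  xs g = refl
push-if true  false xs g = sym (∑-0 xs)
push-if false b     xs g = sym (∑-0 xs)

∑nbrs≡∑² : ∀ n w (Q D : Vec Bool n → Bool) →
  ∑ (vertices n w) (λ x → if Q x then nbrsIn n w x D else 0)
  ≡ ∑² n (λ x z → between w Q D x z * (⟦ shifts x z ⟧ + ⟦ shifts z x ⟧))
∑nbrs≡∑² n w Q D = trans (∑-filter (inJ w) (allVecs n) _) (∑-cong (allVecs n) row)
  where
  nbrsIn≡∑ : ∀ x → nbrsIn n w x D ≡ ∑cube n (λ z → if inJ w z then ⟦ adjᵇ w x z ∧ D z ⟧ else 0)
  nbrsIn≡∑ x = trans (length-filterᵇ (λ y → adjᵇ w x y ∧ D y) (vertices n w)) (∑-filter (inJ w) (allVecs n) _)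
  edge : ∀ x z → (if inJ w x then (if Q x then (if inJ w z then ⟦ adjᵇ w x z ∧ D z ⟧ else 0) else 0) else 0)
               ≡ between w Q D x z * (⟦ shifts x z ⟧ + ⟦ shifts z x ⟧)
  edge x z with inJ w x in x∈J | Q x | inJ w z in z∈J | D z
  ... | false | _     | _     | _     = refl
  ... | true  | false | true  | _     = refl
  ... | true  | false | false | _     = refl
  ... | true  | true  | false | _     = refl
  ... | true  | true  | true  | false rewrite ∧-zeroʳ (adjᵇ w x z) = refl
  ... | true  | true  | true  | true  rewrite ∧-identityʳ (adjᵇ w x z) =
    trans (adjᵇ-shifts w x z x∈J z∈J) (sym (+-identityʳ _))
  row : ∀ x → (if inJ w x then (if Q x then nbrsIn n w x D else 0) else 0)
            ≡ ∑cube n (λ z → between w Q D x z * (⟦ shifts x z ⟧ + ⟦ shifts z x ⟧))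
  row x = begin
    (if inJ w x then (if Q x then nbrsIn n w x D else 0) else 0)
      ≡⟨ cong (λ t → if inJ w x then (if Q x then t else 0) else 0) (nbrsIn≡∑ x) ⟩
    (if inJ w x then (if Q x then ∑cube n (λ z → if inJ w z then ⟦ adjᵇ w x z ∧ D z ⟧ else 0) else 0) else 0)
      ≡⟨ push-if (inJ w x) (Q x) (allVecs n) _ ⟩
    ∑cube n (λ z → if inJ w x then (if Q x then (if inJ w z then ⟦ adjᵇ w x z ∧ D z ⟧ else 0) else 0) else 0)
      ≡⟨ ∑-cong (allVecs n) (edge x) ⟩
    ∑cube n (λ z → between w Q D x z * (⟦ shifts x z ⟧ + ⟦ shifts z x ⟧)) ∎

weight-insertAt : ∀ {n} (v : Vec Bool n) k b → weight (insertAt v k b) ≡ ⟦ b ⟧ + weight v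
weight-insertAt v           zero    true  = refl
weight-insertAt v           zero    false = refl
weight-insertAt (true ∷ v)  (suc k) b     = trans (cong suc (weight-insertAt v k b)) (sym (+-suc ⟦ b ⟧ _))
weight-insertAt (false ∷ v) (suc k) b     = weight-insertAt v k b

weight-place : ∀ {m} (i j : Fin (suc (suc m))) (y : Vec Bool m) bᵢ bⱼ →
  weight (place i j y bᵢ bⱼ) ≡ ⟦ bᵢ ⟧ + (⟦ bⱼ ⟧ + weight y)
weight-place i zero    y bᵢ bⱼ = trans (weight-insertAt _ i bᵢ) (cong (⟦ bᵢ ⟧ +_) (weight-insertAt y zero bⱼ))
weight-place i (suc k) y bᵢ bⱼ = trans (weight-insertAt _ i bᵢ) (cong (⟦ bᵢ ⟧ +_) (weight-insertAt y k bⱼ))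

crossing : ∀ {n} → ℕ → (Vec Bool n → Bool) → Kernel n
crossing w P x z = ⟦ inJ w x ∧ inJ w z ∧ (P x xor P z) ⟧

difference≢0 : ∀ (c a b : Bool) →
  (if c then ⟦ not (does ((if a then pos 1 else pos 0) - (if b then pos 1 else pos 0) ≟ pos 0)) ⟧ else 0)
  ≡ ⟦ c ∧ c ∧ (a xor b) ⟧
difference≢0 true  true  true  = refl
difference≢0 true  true  false = refl
difference≢0 true  false true  = refl
difference≢0 true  false false = refl
difference≢0 false a     b     = refl

supportSize≡∑move : ∀ m w (P : Vec Bool (suc (suc m)) → Bool) (i j : Fin (suc (suc m))) →
  supportSize (suc w) (χ P) i j ≡ ∑move m (crossing (suc w) P) i j
supportSize≡∑move m w P i j =
  trans (length-filterᵇ (λ y → not (does (partialDiff (χ P) i j y ≟ pos 0))) (vertices m w))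
  (trans (∑-filter (inJ w) (allVecs m) _) (∑-cong (allVecs m) term))
  where
  term : ∀ y → (if inJ w y then ⟦ not (does (partialDiff (χ P) i j y ≟ pos 0)) ⟧ else 0)
             ≡ crossing (suc w) P (place i j y true false) (place i j y false true)
  term y rewrite weight-place i j y true false | weight-place i j y false true =
    difference≢0 (inJ w y) (P (place i j y true false)) (P (place i j y false true))

sumSupports≡∑² : ∀ n w (P : Vec Bool n → Bool) →
  sumSupports n (suc w) (χ P) ≡ ∑² n (crossing (suc w) P ↾ shifts)
sumSupports≡∑² zero          w P = refl
sumSupports≡∑² (suc zero)    w P = refl
sumSupports≡∑² (suc (suc m)) w P = begin
  sumSupports (suc (suc m)) (suc w) (χ P)
    ≡⟨ sum-concatMap (λ i → map (support i) (filterᵇ (λ j → toℕ i <ᵇ toℕ j) coords)) coords ⟩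
  ∑ coords (λ i → ∑ (filterᵇ (λ j → toℕ i <ᵇ toℕ j) coords) (support i))
    ≡⟨ ∑-cong coords (λ i → ∑-filter (λ j → toℕ i <ᵇ toℕ j) coords (support i)) ⟩
  ∑< (suc (suc m)) support
    ≡⟨ ∑<-cong (suc (suc m)) (λ i j _ → supportSize≡∑move m w P i j) ⟩
  ∑< (suc (suc m)) (∑move m (crossing (suc w) P))
    ≡⟨ sym (∑²-shifts m (crossing (suc w) P)) ⟩
  ∑² (suc (suc m)) (crossing (suc w) P ↾ shifts) ∎
  where
  coords : List (Fin (suc (suc m)))
  coords = allFin (suc (suc m))
  support : Fin (suc (suc m)) → Fin (suc (suc m)) → ℕ
  support = supportSize (suc w) (χ P)

∑²-symmetrise : ∀ n (K G : Kernel n) (r : Vec Bool n → Vec Bool n → Bool) →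
  (∀ x z → K x z + K z x ≡ G x z) →
  ∑² n (λ x z → K x z * (⟦ r x z ⟧ + ⟦ r z x ⟧)) ≡ ∑² n (G ↾ r)
∑²-symmetrise n K G r sym-K = begin
  ∑² n (λ x z → K x z * (⟦ r x z ⟧ + ⟦ r z x ⟧))
    ≡⟨ ∑²-cong n (λ x z → *-distribˡ-+ (K x z) ⟦ r x z ⟧ ⟦ r z x ⟧) ⟩
  ∑² n (λ x z → K x z * ⟦ r x z ⟧ + K x z * ⟦ r z x ⟧)
    ≡⟨ ∑²-+ n _ _ ⟩
  ∑² n (λ x z → K x z * ⟦ r x z ⟧) + ∑² n (λ x z → K x z * ⟦ r z x ⟧)
    ≡⟨ cong (∑² n (λ x z → K x z * ⟦ r x z ⟧) +_) (∑²-transpose n (λ x z → K x z * ⟦ r z x ⟧)) ⟩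
  ∑² n (λ x z → K x z * ⟦ r x z ⟧) + ∑² n (λ x z → K z x * ⟦ r x z ⟧)
    ≡⟨ sym (∑²-+ n _ _) ⟩
  ∑² n (λ x z → K x z * ⟦ r x z ⟧ + K z x * ⟦ r x z ⟧)
    ≡⟨ ∑²-cong n oneOrientation ⟩
  ∑² n (G ↾ r) ∎
  where
  oneOrientation : ∀ x z → K x z * ⟦ r x z ⟧ + K z x * ⟦ r x z ⟧ ≡ (G ↾ r) x z
  oneOrientation x z with r x z
  ... | true  = trans (cong₂ _+_ (*-identityʳ (K x z)) (*-identityʳ (K z x))) (sym-K x z)
  ... | false = cong₂ _+_ (*-zeroʳ (K x z)) (*-zeroʳ (K z x))

sumSupports≡∑nbrs : ∀ n w (P : Vec Bool n → Bool) (q d : Bool → Bool) →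
  (∀ p p′ → ⟦ q p ∧ d p′ ⟧ + ⟦ q p′ ∧ d p ⟧ ≡ ⟦ p xor p′ ⟧) →
  sumSupports n (suc w) (χ P)
  ≡ ∑ (vertices n (suc w)) (λ x → if q (P x) then nbrsIn n (suc w) x (λ y → d (P y)) else 0)
sumSupports≡∑nbrs n w P q d sides = begin
  sumSupports n (suc w) (χ P)
    ≡⟨ sumSupports≡∑² n w P ⟩
  ∑² n (crossing (suc w) P ↾ shifts)
    ≡⟨ sym (∑²-symmetrise n K (crossing (suc w) P) shifts K+Kᵀ) ⟩
  ∑² n (λ x z → K x z * (⟦ shifts x z ⟧ + ⟦ shifts z x ⟧))
    ≡⟨ sym (∑nbrs≡∑² n (suc w) Q D) ⟩
  ∑ (vertices n (suc w)) (λ x → if Q x then nbrsIn n (suc w) x D else 0) ∎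
  where
  Q D : Vec Bool n → Bool
  Q x = q (P x)
  D x = d (P x)
  K : Kernel n
  K = between (suc w) Q D
  K+Kᵀ : ∀ x z → K x z + K z x ≡ crossing (suc w) P x z
  K+Kᵀ x z with inJ (suc w) x | inJ (suc w) z
  ... | true  | true  = sides (P x) (P z)
  ... | true  | false = refl
  ... | false | true  = refl
  ... | false | false = refl

C₁→C₂ : ∀ p p′ → ⟦ p ∧ not p′ ⟧ + ⟦ p′ ∧ not p ⟧ ≡ ⟦ p xor p′ ⟧
C₁→C₂ true  true  = refl
C₁→C₂ true  false = refl
C₁→C₂ false true  = refl
C₁→C₂ false false = refl

C₂→C₁ : ∀ p p′ → ⟦ not p ∧ p′ ⟧ + ⟦ not p′ ∧ p ⟧ ≡ ⟦ p xor p′ ⟧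
C₂→C₁ true  true  = refl
C₂→C₁ true  false = refl
C₂→C₁ false true  = refl
C₂→C₁ false false = refl

∑nbrs-regular : ∀ n w (Q D : Vec Bool n → Bool) k →
  (∀ x → x ∈ vertices n w → Q x ≡ true → nbrsIn n w x D ≡ k) →
  ∑ (vertices n w) (λ x → if Q x then nbrsIn n w x D else 0) ≡ k * ∑ (vertices n w) (λ x → ⟦ Q x ⟧)
∑nbrs-regular n w Q D k regular = trans (∑-cong∈ (vertices n w) row) (sym (∑-*ˡ (vertices n w) k _))
  where
  row : ∀ x → x ∈ vertices n w → (if Q x then nbrsIn n w x D else 0) ≡ k * ⟦ Q x ⟧
  row x x∈V with Q x in Qx
  ... | true  = trans (regular x x∈V Qx) (sym (*-identityʳ k))
  ... | false = sym (*-zeroʳ k)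

∑cube-inJ : ∀ n w → ∑cube n (λ v → ⟦ inJ w v ⟧) ≡ n C w
∑cube-inJ zero    zero    = refl
∑cube-inJ zero    (suc w) = refl
∑cube-inJ (suc n) zero    =
  trans (∑cube-step n _) (trans (cong (_+ ∑cube n (λ v → ⟦ inJ 0 v ⟧)) (∑-0 (allVecs n))) (∑cube-inJ n zero))
∑cube-inJ (suc n) (suc w) =
  trans (∑cube-step n _) (trans (cong₂ _+_ (∑cube-inJ n w) (∑cube-inJ n (suc w))) (nCk+nC[k+1]≡[n+1]C[k+1] n w))

partSizes : ∀ n w (P : Vec Bool n → Bool) →
  ∑ (vertices n w) (λ x → ⟦ P x ⟧) + ∑ (vertices n w) (λ x → ⟦ not (P x) ⟧) ≡ n C w
partSizes n w P = begin
  ∑ V (λ x → ⟦ P x ⟧) + ∑ V (λ x → ⟦ not (P x) ⟧) ≡⟨ sym (∑-+ V _ _) ⟩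
  ∑ V (λ x → ⟦ P x ⟧ + ⟦ not (P x) ⟧)              ≡⟨ ∑-cong V oneSide ⟩
  ∑ V (λ _ → 1)                                    ≡⟨ sym (length≡∑1 V) ⟩
  length V                                         ≡⟨ length-filterᵇ (inJ w) (allVecs n) ⟩
  ∑cube n (λ v → ⟦ inJ w v ⟧)                      ≡⟨ ∑cube-inJ n w ⟩
  n C w                                            ∎
  where
  V : List (Vec Bool n)
  V = vertices n w
  oneSide : ∀ x → ⟦ P x ⟧ + ⟦ not (P x) ⟧ ≡ 1
  oneSide x with P x
  ... | true  = refl
  ... | false = refl

doubleCount : ∀ b c E N₁ N₂ → E ≡ b * N₁ → E ≡ c * N₂ → (b + c) * E ≡ b * c * (N₁ + N₂)
doubleCount b c E N₁ N₂ E≡bN₁ E≡cN₂ = begin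
  (b + c) * E                 ≡⟨ *-distribʳ-+ E b c ⟩
  b * E + c * E               ≡⟨ cong₂ (λ u v → b * u + c * v) E≡cN₂ E≡bN₁ ⟩
  b * (c * N₂) + c * (b * N₁) ≡⟨ cong₂ _+_ (sym (*-assoc b c N₂))
                                   (trans (sym (*-assoc c b N₁)) (cong (_* N₁) (*-comm c b))) ⟩
  b * c * N₂ + b * c * N₁     ≡⟨ trans (+-comm (b * c * N₂) (b * c * N₁)) (sym (*-distribˡ-+ (b * c) N₁ N₂)) ⟩
  b * c * (N₁ + N₂)           ∎

lemma4 : (n w : ℕ) (P : Vec Bool n → Bool) (a b c d : ℕ) →
    IsEquitable n w P a b c d →
    (b + c) * sumSupports n w (χ P) ≡ b * c * (n C w)
lemma4 n zero P a b c d eq = begin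
  (b + c) * sumSupports n 0 (χ P) ≡⟨ cong₂ (λ u v → (u + v) * sumSupports n 0 (χ P)) b≡0 c≡0 ⟩
  0                               ≡⟨ cong (λ u → u * c * (n C 0)) (sym b≡0) ⟩
  b * c * (n C 0)                 ∎
  where
  -- J(n,0) has no edges, so the off-diagonal entries of the quotient matrix vanish
  open IsEquitable eq
  b≡0 : b ≡ 0
  b≡0 with x , x∈V , Px ← C₁-nonempty = trans (sym (row₁₂ x x∈V Px)) (nbrsIn-J0 n x _)
  c≡0 : c ≡ 0
  c≡0 with x , x∈V , Px ← C₂-nonempty = trans (sym (row₂₁ x x∈V Px)) (nbrsIn-J0 n x _)
lemma4 n (suc w) P a b c d eq =
  trans (doubleCount b c S N₁ N₂ S≡bN₁ S≡cN₂) (cong (b * c *_) (partSizes n (suc w) P))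
  where
  open IsEquitable eq
  S N₁ N₂ : ℕ
  S  = sumSupports n (suc w) (χ P)
  N₁ = ∑ (vertices n (suc w)) (λ x → ⟦ P x ⟧)
  N₂ = ∑ (vertices n (suc w)) (λ x → ⟦ not (P x) ⟧)
  -- counting the edges from C₁ to C₂ at their C₁ end, then at their C₂ end
  S≡bN₁ : S ≡ b * N₁
  S≡bN₁ = trans (sumSupports≡∑nbrs n w P (λ p → p) not C₁→C₂)
                (∑nbrs-regular n (suc w) P (λ y → not (P y)) b row₁₂)
  S≡cN₂ : S ≡ c * N₂
  S≡cN₂ = trans (sumSupports≡∑nbrs n w P not (λ p → p) C₂→C₁)
                (∑nbrs-regular n (suc w) (λ y → not (P y)) P c
                  (λ x x∈V ¬Px → row₂₁ x x∈V (not-injective {y = false} ¬Px)))
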